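{- ${\rm Nim}(\mathcal{J}(0,0))=1$, ${\rm Nim}(\mathcal{J}(2,1))=2$, and ${\rm Nim}(\mathcal{J}(2k,k))=0$ for all integers $k\ge 2$.
   Context: Chomp on a finite poset $P$ with global minimum $0$: two players alternately pick an element $x$ of the remaining poset and remove all elements $\ge x$; the player forced to pick $0$ loses. ${\rm Nim}(\{0\})=0$ and ${\rm Nim}(P)=\mathrm{mex}\{{\rm Nim}(P_x) : x\in P\setminus\{0\}\}$, where $P_x$ is $P$ with the up-set of $x$ removed. A finite graph is regarded as the poset of the empty set, its vertices and its edges ordered by inclusion. The Johnson graph $\mathcal{J}(n,k)$ ($0\le k\le n$) has as vertices the $k$-element subsets of an $n$-element set, two vertices adjacent iff the sets intersect in exactly $k-1$ elements. -}

module Defs where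

open import Data.Nat using (ℕ; zero; suc; _+_; _≡ᵇ_)
open import Data.Nat.Properties using () renaming (_≟_ to _≟ℕ_)
open import Data.Bool using (Bool; true; false; not; _∨_; _∧_; if_then_else_)
open import Data.Bool.Properties using () renaming (_≟_ to _≟B_)
open import Data.List using (List; []; _∷_; map; _++_; length; filterᵇ; concatMap)
open import Data.Product using (_×_; _,_; proj₁; proj₂)
open import Data.Vec using (Vec; []; _∷_)
open import Data.Vec.Properties using (≡-dec)
open import Data.Fin.Subset using (Subset; ∣_∣; _∩_; inside; outside)
open import Relation.Nullary using (Dec; yes; no)
open import Relation.Nullary.Decidable using (isYes)
open import Relation.Binary.PropositionalEquality using (_≡_)
open import Relation.Binary.Definitions using (DecidableEquality)

-- A finite (simple) graph: a vertex type with decidable equality, a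
-- duplicate-free list of vertices and a duplicate-free list of edges,
-- each edge an unordered pair {u , v} (u ≢ v) listed exactly once.
record Graph : Set₁ where
  field
    V        : Set
    _≟V_     : DecidableEquality V
    vertices : List V
    edges    : List (V × V)

-- A position of Chomp on the poset of a graph is a down-set containing ∅:
-- the remaining vertices and the remaining edges (whose endpoints remain).
-- The global minimum ∅ is implicit (always present).
Position : Set → Set
Position A = List A × List (A × A)

picks : {A : Set} → List A → List (A × List A)
picks []       = []
picks (x ∷ xs) = (x , xs) ∷ map (λ p → proj₁ p , x ∷ proj₂ p) (picks xs)

-- all positions reachable in one move (choosing some x ≠ ∅ and removing
-- its up-set): choosing a vertex v removes v and every edge containing v;
-- choosing an edge removes just that edge.
options : {A : Set} → DecidableEquality A → Position A → List (Position A)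
options {A} _≟_ (vs , es) =
     map (λ p → proj₂ p , filterᵇ (λ e → not (isYes (proj₁ e ≟ proj₁ p) ∨ isYes (proj₂ e ≟ proj₁ p))) es)
         (picks vs)
  ++ map (λ p → vs , proj₂ p) (picks es)

elemℕ : ℕ → List ℕ → Bool
elemℕ n []       = false
elemℕ n (m ∷ ms) = (n ≡ᵇ m) ∨ elemℕ n ms

-- mex: least natural number not in the list (search from i, fuel f;
-- fuel length l + 1 always suffices)
mexFrom : ℕ → ℕ → List ℕ → ℕ
mexFrom i zero    l = i
mexFrom i (suc f) l = if elemℕ i l then mexFrom (suc i) f l else i

mex : List ℕ → ℕ
mex l = mexFrom 0 (suc (length l)) l

-- Nim value with fuel; each move removes at least one element, so fuel equal to
-- the number of non-minimal elements of the position is enough.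
nimF : {A : Set} → DecidableEquality A → ℕ → Position A → ℕ
nimF _≟_ zero    p = 0
nimF _≟_ (suc f) p = mex (map (nimF _≟_ f) (options _≟_ p))

size : {A : Set} → Position A → ℕ
size (vs , es) = length vs + length es

Nim : Graph → ℕ
Nim G = nimF _≟V_ (size start) start
  where
    open Graph G
    start = vertices , edges

allSubsets : (n : ℕ) → List (Subset n)
allSubsets zero    = [] ∷ []
allSubsets (suc n) = map (outside ∷_) (allSubsets n) ++ map (inside ∷_) (allSubsets n)

pairs : {A : Set} → List A → List (A × A)
pairs []       = []
pairs (x ∷ xs) = map (x ,_) xs ++ pairs xs

-- J(n,k): vertices the k-subsets of Fin n; u ~ v iff |u ∩ v| = k - 1
-- (written suc |u ∩ v| = k to avoid truncated subtraction)
Johnson : ℕ → ℕ → Graph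
Johnson n k = record
  { V        = Subset n
  ; _≟V_     = ≡-dec _≟B_
  ; vertices = verts
  ; edges    = filterᵇ (λ e → suc ∣ proj₁ e ∩ proj₂ e ∣ ≡ᵇ k) (pairs verts)
  }
  where
    verts = filterᵇ (λ s → ∣ s ∣ ≡ᵇ k) (allSubsets n)

-- Complementation σ is a fixed-point-free automorphism of J(2k,k), and for k ≥ 2
-- no vertex is adjacent to its complement (they meet in 0 ≠ k - 1 elements).
-- So in a position invariant under σ, the second player answers a vertex by its
-- mirror vertex and an edge by its mirror edge, which are distinct from the chosen
-- element and still present; the answer restores invariance. Hence every option of
-- a σ-invariant position has an option of value 0, and the position has value 0.
module Submission where

open import Defs
open import Data.Nat using (ℕ; _*_; _≤_)
open import Data.Product using (_×_)
open import Relation.Binary.PropositionalEquality using (_≡_)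

open import Data.Bool using (Bool; true; false; not; _∨_; _∧_; if_then_else_)
open import Data.Bool.Properties using (∨-comm; ∧-comm; ∨-zeroʳ; if-eta) renaming (_≟_ to _≟B_)
open import Data.Empty using (⊥-elim)
open import Data.List using (List; []; _∷_; map; _++_; length; filterᵇ)
open import Data.List.Membership.Propositional using (_∈_; _∉_)
open import Data.List.Membership.Propositional.Properties using (∈-map⁺; ∈-map⁻; ∈-++⁺ˡ; ∈-++⁺ʳ; ∈-++⁻; ∈-filter⁻)
open import Data.List.Properties using (length-filter)
open import Data.List.Relation.Unary.Any using (here; there)
open import Data.Nat using (zero; suc; _+_; _<_; _≡ᵇ_; s≤s)
open import Data.Nat.Combinatorics using (_C_; nC1≡n; nCk+nC[k+1]≡[n+1]C[k+1])
open import Data.Nat.Properties using (≤-refl; ≤-reflexive; ≤-trans; <-≤-trans; n≤1+n; +-comm; +-assoc; +-suc; +-identityʳ; +-cancelˡ-≡; +-cancelʳ-≡; +-monoʳ-≤; +-monoʳ-<; ≤-pred; n≮0; <-irrefl; 0≢1+n; ≡ᵇ⇒≡; *-suc; m∸n+n≡m)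
  renaming (_≟_ to _≟ℕ_)
open import Data.Product using (Σ; ∃₂; _,_; proj₁; proj₂)
open import Data.Sum using (_⊎_; inj₁; inj₂)
open import Data.Fin.Subset using (Subset; ∣_∣; _∩_; ∁; inside; outside)
open import Data.Fin.Subset.Properties using (∣∁p∣≡n∸∣p∣; ∣p∣≤n; ∩-comm; ∩-inverseʳ; ∣⊥∣≡0; ∪-∩-booleanAlgebra)
open import Data.Vec using ([]; _∷_)
open import Data.Vec.Properties using (≡-dec; ∷-injective)
open import Function using (_∘_; _⇔_; mk⇔; Equivalence)
open import Level using (0ℓ)
open import Relation.Binary using (Rel; IsDecEquivalence)
open import Relation.Binary.Definitions using (DecidableEquality)
open import Relation.Binary.PropositionalEquality using (_≢_; refl; sym; trans; cong; cong₂; subst; module ≡-Reasoning)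
open import Relation.Binary.PropositionalEquality.Properties using (isDecEquivalence)
open import Relation.Nullary using (Dec; yes; no; ¬_; does)
open import Relation.Nullary.Decidable using (isYes; isYes≗does; _×-dec_; _⊎-dec_; dec-true; dec-false; does-⇔; T?)
open import Relation.Unary using (Decidable)
import Algebra.Lattice.Properties.BooleanAlgebra as BooleanAlgebra
import Relation.Nullary.Decidable as Dec

indicator : {P : Set} → Dec P → ℕ
indicator P? = if does P? then 1 else 0

indicator-yes : {P : Set} (P? : Dec P) → P → indicator P? ≡ 1
indicator-yes P? p = cong (λ b → if b then 1 else 0) (dec-true P? p)

indicator-no : {P : Set} (P? : Dec P) → ¬ P → indicator P? ≡ 0
indicator-no P? ¬p = cong (λ b → if b then 1 else 0) (dec-false P? ¬p)

indicator-⇔ : {P Q : Set} (P? : Dec P) (Q? : Dec Q) → P ⇔ Q → indicator P? ≡ indicator Q?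
indicator-⇔ P? Q? P⇔Q = cong (λ b → if b then 1 else 0) (does-⇔ P⇔Q P? Q?)

private
  variable
    B : Set
    x y : B
    xs ys : List B

count : {P : B → Set} → Decidable P → List B → ℕ
count P? []       = 0
count P? (x ∷ xs) = indicator (P? x) + count P? xs

data Pick {B : Set} : B → List B → List B → Set where
  here  : ∀ {x xs} → Pick x (x ∷ xs) xs
  there : ∀ {x y xs ys} → Pick x xs ys → Pick x (y ∷ xs) (y ∷ ys)

Pick⇒∈ : Pick x xs ys → x ∈ xs
Pick⇒∈ here       = here refl
Pick⇒∈ (there pk) = there (Pick⇒∈ pk)

Pick-∈ : Pick x xs ys → y ∈ ys → y ∈ xs
Pick-∈ here       y∈ys         = there y∈ys
Pick-∈ (there pk) (here y≡z)   = here y≡z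
Pick-∈ (there pk) (there y∈ys) = there (Pick-∈ pk y∈ys)

Pick-length : Pick x xs ys → length xs ≡ suc (length ys)
Pick-length here       = refl
Pick-length (there pk) = cong suc (Pick-length pk)

∈-picks⁺ : Pick x xs ys → (x , ys) ∈ picks xs
∈-picks⁺ here               = here refl
∈-picks⁺ (there {y = y} pk) = there (∈-map⁺ (λ p → proj₁ p , y ∷ proj₂ p) (∈-picks⁺ pk))

∈-picks⁻ : (x , ys) ∈ picks xs → Pick x xs ys
∈-picks⁻ {xs = y ∷ xs} (here refl) = here
∈-picks⁻ {xs = y ∷ xs} (there m) with ∈-map⁻ _ m
... | (_ , _) , m′ , refl = there (∈-picks⁻ m′)

∈-pairs⁻ : ∀ {e : B × B} xs → e ∈ pairs xs → proj₁ e ∈ xs × proj₂ e ∈ xs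
∈-pairs⁻ (x ∷ xs) e∈ with ∈-++⁻ (map (x ,_) xs) e∈
... | inj₁ e∈fan with y , y∈xs , refl ← ∈-map⁻ (x ,_) e∈fan = here refl , there y∈xs
... | inj₂ e∈rest with a∈ , b∈ ← ∈-pairs⁻ xs e∈rest = there a∈ , there b∈

module _ {P : B → Set} (P? : Decidable P) where

  count-++ : ∀ xs ys → count P? (xs ++ ys) ≡ count P? xs + count P? ys
  count-++ []       ys = refl
  count-++ (x ∷ xs) ys = trans (cong (indicator (P? x) +_) (count-++ xs ys)) (sym (+-assoc (indicator (P? x)) _ _))

  count-none : (∀ x → ¬ P x) → ∀ xs → count P? xs ≡ 0
  count-none ¬P []       = refl
  count-none ¬P (x ∷ xs) = cong₂ _+_ (indicator-no (P? x) (¬P x)) (count-none ¬P xs)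

  count-Pick : Pick x xs ys → count P? xs ≡ indicator (P? x) + count P? ys
  count-Pick here = refl
  count-Pick {x} (there {y = y} {xs} {ys} pk) = begin
    indicator (P? y) + count P? xs                     ≡⟨ cong (indicator (P? y) +_) (count-Pick pk) ⟩
    indicator (P? y) + (indicator (P? x) + count P? ys) ≡⟨ sym (+-assoc (indicator (P? y)) _ _) ⟩
    indicator (P? y) + indicator (P? x) + count P? ys   ≡⟨ cong (_+ count P? ys) (+-comm (indicator (P? y)) _) ⟩
    indicator (P? x) + indicator (P? y) + count P? ys   ≡⟨ +-assoc (indicator (P? x)) _ _ ⟩
    indicator (P? x) + (indicator (P? y) + count P? ys) ∎
    where open ≡-Reasoning

  count≢0⇒Pick : ∀ xs → count P? xs ≢ 0 → ∃₂ λ x ys → P x × Pick x xs ys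
  count≢0⇒Pick []       c≢0 = ⊥-elim (c≢0 refl)
  count≢0⇒Pick (x ∷ xs) c≢0 with P? x
  ... | yes px = x , xs , px , here
  ... | no  _  with count≢0⇒Pick xs c≢0
  ...   | y , ys , py , pk = y , x ∷ ys , py , there pk

  count-filterᵇ : ∀ (Q : B → Bool) {b} → (∀ {x} → P x → Q x ≡ b) → ∀ xs →
                  count P? (filterᵇ Q xs) ≡ (if b then count P? xs else 0)
  count-filterᵇ Q {b} Q≡b []       = sym (if-eta b)
  count-filterᵇ Q Q≡b (x ∷ xs) with Q x in Qx
  ... | true  with P? x
  ...   | no _   = count-filterᵇ Q Q≡b xs
  ...   | yes px with refl ← trans (sym Qx) (Q≡b px) = cong suc (count-filterᵇ Q Q≡b xs)
  count-filterᵇ Q Q≡b (x ∷ xs) | false with P? x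
  ...   | no _   = count-filterᵇ Q Q≡b xs
  ...   | yes px with refl ← trans (sym Qx) (Q≡b px) = count-filterᵇ Q Q≡b xs

count-map : ∀ {C : Set} {P : C → Set} (P? : Decidable P) (f : B → C) xs →
            count P? (map f xs) ≡ count (P? ∘ f) xs
count-map P? f []       = refl
count-map P? f (x ∷ xs) = cong (indicator (P? (f x)) +_) (count-map P? f xs)

count-⇔ : ∀ {P Q : B → Set} (P? : Decidable P) (Q? : Decidable Q) → (∀ x → P x ⇔ Q x) →
          ∀ xs → count P? xs ≡ count Q? xs
count-⇔ P? Q? P⇔Q []       = refl
count-⇔ P? Q? P⇔Q (x ∷ xs) = cong₂ _+_ (indicator-⇔ (P? x) (Q? x) (P⇔Q x)) (count-⇔ P? Q? P⇔Q xs)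

filterᵇ-filterᵇ : ∀ (P Q : B → Bool) xs → filterᵇ P (filterᵇ Q xs) ≡ filterᵇ (λ x → Q x ∧ P x) xs
filterᵇ-filterᵇ P Q []       = refl
filterᵇ-filterᵇ P Q (x ∷ xs) with Q x
... | false = filterᵇ-filterᵇ P Q xs
... | true with P x
...   | true  = cong (x ∷_) (filterᵇ-filterᵇ P Q xs)
...   | false = filterᵇ-filterᵇ P Q xs

elemℕ-∈ : ∀ {n ns} → n ∈ ns → elemℕ n ns ≡ true
elemℕ-∈ {n} (here {xs = ms} refl) = cong (_∨ elemℕ n ms) (dec-true (n ≟ℕ n) refl)
elemℕ-∈ {n} (there {x = m} n∈ns) = trans (cong ((n ≡ᵇ m) ∨_) (elemℕ-∈ n∈ns)) (∨-zeroʳ (n ≡ᵇ m))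

elemℕ-∉ : ∀ n ns → n ∉ ns → elemℕ n ns ≡ false
elemℕ-∉ n []       n∉ns = refl
elemℕ-∉ n (m ∷ ms) n∉ns =
  cong₂ _∨_ (dec-false (n ≟ℕ m) (n∉ns ∘ here)) (elemℕ-∉ n ms (n∉ns ∘ there))

mexFrom-≥ : ∀ i f ns → i ≤ mexFrom i f ns
mexFrom-≥ i zero    ns = ≤-refl
mexFrom-≥ i (suc f) ns with elemℕ i ns
... | true  = ≤-trans (n≤1+n i) (mexFrom-≥ (suc i) f ns)
... | false = ≤-refl

mex≡0 : ∀ ns → 0 ∉ ns → mex ns ≡ 0
mex≡0 ns 0∉ns rewrite elemℕ-∉ 0 ns 0∉ns = refl

1≤mex : ∀ ns → 0 ∈ ns → 1 ≤ mex ns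
1≤mex ns 0∈ns rewrite elemℕ-∈ 0∈ns = mexFrom-≥ 1 (length ns) ns

mex≢0 : ∀ ns → 0 ∈ ns → mex ns ≢ 0
mex≢0 ns 0∈ns mex≡0 = n≮0 (subst (0 <_) mex≡0 (1≤mex ns 0∈ns))

module Chomp {A : Set} (_≟_ : DecidableEquality A) where

  private
    variable
      p q : Position A

  avoids : A → A × A → Bool
  avoids v e = not (isYes (proj₁ e ≟ v) ∨ isYes (proj₂ e ≟ v))

  data Move : Position A → Position A → Set where
    delete-vertex : ∀ {v vs vs′ es} → Pick v vs vs′ → Move (vs , es) (vs′ , filterᵇ (avoids v) es)
    delete-edge   : ∀ {e vs es es′} → Pick e es es′ → Move (vs , es) (vs , es′)

  Move⇒∈-options : Move p q → q ∈ options _≟_ p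
  Move⇒∈-options (delete-vertex pk) = ∈-++⁺ˡ (∈-map⁺ _ (∈-picks⁺ pk))
  Move⇒∈-options {vs , _} (delete-edge pk) = ∈-++⁺ʳ (map _ (picks vs)) (∈-map⁺ _ (∈-picks⁺ pk))

  ∈-options⇒Move : q ∈ options _≟_ p → Move p q
  ∈-options⇒Move {p = vs , es} q∈ with ∈-++⁻ (map _ (picks vs)) q∈
  ... | inj₁ q∈ᵥ with (v , vs′) , m , refl ← ∈-map⁻ _ q∈ᵥ = delete-vertex (∈-picks⁻ m)
  ... | inj₂ q∈ₑ with (e , es′) , m , refl ← ∈-map⁻ _ q∈ₑ = delete-edge (∈-picks⁻ m)

  Move-shrinks : Move p q → size q < size p
  Move-shrinks (delete-vertex {v} {vs} {vs′} {es} pk) rewrite Pick-length pk =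
    s≤s (+-monoʳ-≤ (length vs′) (length-filter (T? ∘ avoids v) es))
  Move-shrinks (delete-edge {vs = vs} pk) =
    +-monoʳ-< (length vs) (≤-reflexive (sym (Pick-length pk)))

  nim≡0 : ∀ {f} → (∀ {q} → Move p q → nimF _≟_ f q ≢ 0) → nimF _≟_ (suc f) p ≡ 0
  nim≡0 {p} {f} noZero = mex≡0 _ no-option-has-value-0
    where
    no-option-has-value-0 : 0 ∉ map (nimF _≟_ f) (options _≟_ p)
    no-option-has-value-0 0∈ with q , q∈ , 0≡nim ← ∈-map⁻ (nimF _≟_ f) 0∈ =
      noZero (∈-options⇒Move q∈) (sym 0≡nim)

  nim≢0 : ∀ {f} → Move p q → nimF _≟_ f q ≡ 0 → nimF _≟_ (suc f) p ≢ 0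
  nim≢0 {f = f} p→q nim≡0 =
    mex≢0 _ (subst (_∈ _) nim≡0 (∈-map⁺ (nimF _≟_ f) (Move⇒∈-options p→q)))

module Balance {B : Set} {_≈_ : Rel B 0ℓ} (≈-isDecEquivalence : IsDecEquivalence _≈_)
               (τ : B → B) (τ-cong : ∀ {x y} → x ≈ y → τ x ≈ τ y)
               (τ-involutive : ∀ x → τ (τ x) ≈ x) where

  open IsDecEquivalence ≈-isDecEquivalence
    renaming (_≟_ to _≈?_; refl to ≈-refl; sym to ≈-sym; trans to ≈-trans)

  multiplicity : B → List B → ℕ
  multiplicity d = count (_≈? d)

  Balanced : List B → Set
  Balanced xs = ∀ d → multiplicity d xs ≡ multiplicity (τ d) xs

  τ-transpose : ∀ {x y} → τ x ≈ y ⇔ x ≈ τ y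
  τ-transpose = mk⇔ (λ τx≈y → ≈-trans (≈-sym (τ-involutive _)) (τ-cong τx≈y))
                    (λ x≈τy → ≈-trans (τ-cong x≈τy) (τ-involutive _))

  balanced⇒mirror-Pick : ∀ {x xs ys} → Balanced xs → Pick x xs ys → ¬ x ≈ τ x →
                         ∃₂ λ x′ zs → x′ ≈ τ x × Pick x′ ys zs
  balanced⇒mirror-Pick {x} {xs} {ys} bal pk x≉τx =
    count≢0⇒Pick (_≈? τ x) ys (λ m≡0 → 0≢1+n (trans (sym m≡0) mirror-count))
    where
    open ≡-Reasoning
    mirror-count : multiplicity (τ x) ys ≡ suc (multiplicity x ys)
    mirror-count = begin
      multiplicity (τ x) ys                         ≡⟨ cong (_+ multiplicity (τ x) ys) (indicator-no (x ≈? τ x) x≉τx) ⟨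
      indicator (x ≈? τ x) + multiplicity (τ x) ys  ≡⟨ count-Pick (_≈? τ x) pk ⟨
      multiplicity (τ x) xs                         ≡⟨ bal x ⟨
      multiplicity x xs                             ≡⟨ count-Pick (_≈? x) pk ⟩
      indicator (x ≈? x) + multiplicity x ys        ≡⟨ cong (_+ multiplicity x ys) (indicator-yes (x ≈? x) ≈-refl) ⟩
      suc (multiplicity x ys)                       ∎

  balanced-Pick-mirror : ∀ {x x′ xs ys zs} → Balanced xs → Pick x xs ys → x′ ≈ τ x → Pick x′ ys zs → Balanced zs
  balanced-Pick-mirror {x} {x′} {xs} {ys} {zs} bal pk x′≈τx pk′ d =
    +-cancelˡ-≡ (i + j) _ _ (begin
      i + j + multiplicity d zs                                     ≡⟨ count-Pick₂ d ⟨
      multiplicity d xs                                             ≡⟨ bal d ⟩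
      multiplicity (τ d) xs                                         ≡⟨ count-Pick₂ (τ d) ⟩
      indicator (x ≈? τ d) + indicator (x′ ≈? τ d) + multiplicity (τ d) zs
        ≡⟨ cong (_+ multiplicity (τ d) zs) (trans (cong₂ _+_ x-swaps x′-swaps) (+-comm j i)) ⟩
      i + j + multiplicity (τ d) zs                                 ∎)
    where
    open ≡-Reasoning
    i j : ℕ
    i = indicator (x ≈? d)
    j = indicator (x′ ≈? d)
    count-Pick₂ : ∀ d → multiplicity d xs ≡ indicator (x ≈? d) + indicator (x′ ≈? d) + multiplicity d zs
    count-Pick₂ d = trans (count-Pick (_≈? d) pk)
      (trans (cong (indicator (x ≈? d) +_) (count-Pick (_≈? d) pk′)) (sym (+-assoc (indicator (x ≈? d)) _ _)))
    x-swaps : indicator (x ≈? τ d) ≡ j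
    x-swaps = indicator-⇔ (x ≈? τ d) (x′ ≈? d) (mk⇔
      (λ x≈τd → ≈-trans x′≈τx (Equivalence.from τ-transpose x≈τd))
      (λ x′≈d → Equivalence.to τ-transpose (≈-trans (≈-sym x′≈τx) x′≈d)))
    x′-swaps : indicator (x′ ≈? τ d) ≡ i
    x′-swaps = indicator-⇔ (x′ ≈? τ d) (x ≈? d) (mk⇔
      (λ x′≈τd → ≈-trans (≈-sym (τ-involutive x)) (Equivalence.from τ-transpose (≈-trans (≈-sym x′≈τx) x′≈τd)))
      (λ x≈d → ≈-trans x′≈τx (τ-cong x≈d)))

  balanced-filterᵇ : ∀ {xs} (Q : B → Bool) → (∀ {x y} → x ≈ y → Q x ≡ Q y) →
                     (∀ {x} → x ∈ xs → Q (τ x) ≡ Q x) → Balanced xs → Balanced (filterᵇ Q xs)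
  balanced-filterᵇ {xs} Q Q-resp Q-τ bal d = begin
    multiplicity d (filterᵇ Q xs)                      ≡⟨ count-filterᵇ (_≈? d) Q Q-resp xs ⟩
    (if Q d then multiplicity d xs else 0)             ≡⟨ kept-balanced ⟩
    (if Q (τ d) then multiplicity (τ d) xs else 0)     ≡⟨ count-filterᵇ (_≈? τ d) Q Q-resp xs ⟨
    multiplicity (τ d) (filterᵇ Q xs)                  ∎
    where
    open ≡-Reasoning
    vanish : ∀ b {m} → m ≡ 0 → (if b then m else 0) ≡ 0
    vanish b refl = if-eta b
    kept-balanced : (if Q d then multiplicity d xs else 0) ≡ (if Q (τ d) then multiplicity (τ d) xs else 0)
    kept-balanced with multiplicity d xs ≟ℕ 0
    ... | yes m≡0 = trans (vanish (Q d) m≡0) (sym (vanish (Q (τ d)) (trans (sym (bal d)) m≡0)))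
    ... | no  m≢0 with x , _ , x≈d , pk ← count≢0⇒Pick (_≈? d) xs m≢0 =
      cong₂ (λ b m → if b then m else 0)
        (trans (Q-resp (≈-sym x≈d)) (trans (sym (Q-τ (Pick⇒∈ pk))) (Q-resp (τ-cong x≈d))))
        (bal d)

data _≐_ {A : Set} : Rel (A × A) 0ℓ where
  ≐-direct  : ∀ {a b} → (a , b) ≐ (a , b)
  ≐-swapped : ∀ {a b} → (a , b) ≐ (b , a)

≐-cases : ∀ {A : Set} {a b c d : A} → (a , b) ≐ (c , d) → (a ≡ c × b ≡ d) ⊎ (a ≡ d × b ≡ c)
≐-cases ≐-direct  = inj₁ (refl , refl)
≐-cases ≐-swapped = inj₂ (refl , refl)

module UnorderedPairs {A : Set} (_≟_ : DecidableEquality A) where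

  ≐-isDecEquivalence : IsDecEquivalence (_≐_ {A})
  ≐-isDecEquivalence = record
    { isEquivalence = record { refl = ≐-direct ; sym = ≐-sym ; trans = ≐-trans }
    ; _≟_           = _≐?_
    }
    where
    ≐-sym : ∀ {e d : A × A} → e ≐ d → d ≐ e
    ≐-sym ≐-direct  = ≐-direct
    ≐-sym ≐-swapped = ≐-swapped
    ≐-trans : ∀ {e d c : A × A} → e ≐ d → d ≐ c → e ≐ c
    ≐-trans ≐-direct  d≐c       = d≐c
    ≐-trans ≐-swapped ≐-direct  = ≐-swapped
    ≐-trans ≐-swapped ≐-swapped = ≐-direct
    _≐?_ : (e d : A × A) → Dec (e ≐ d)
    (a , b) ≐? (c , d) = Dec.map (mk⇔ from ≐-cases) ((a ≟ c ×-dec b ≟ d) ⊎-dec (a ≟ d ×-dec b ≟ c))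
      where
      from : (a ≡ c × b ≡ d) ⊎ (a ≡ d × b ≡ c) → (a , b) ≐ (c , d)
      from (inj₁ (refl , refl)) = ≐-direct
      from (inj₂ (refl , refl)) = ≐-swapped

  open IsDecEquivalence ≐-isDecEquivalence public using () renaming (_≟_ to _≐?_)

  count-pairs-∷ : ∀ {P : A × A → Set} (P? : Decidable P) x xs →
                  count P? (pairs (x ∷ xs)) ≡ count (P? ∘ (x ,_)) xs + count P? (pairs xs)
  count-pairs-∷ P? x xs = trans (count-++ P? (map (x ,_) xs) (pairs xs)) (cong (_+ _) (count-map P? (x ,_) xs))

  ≐-shared-first : ∀ {a b y : A} → (a , y) ≐ (a , b) ⇔ y ≡ b
  ≐-shared-first = mk⇔ (λ { ≐-direct → refl ; ≐-swapped → refl }) (λ { refl → ≐-direct })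

  ≐-shared-cross : ∀ {a b y : A} → (b , y) ≐ (a , b) ⇔ y ≡ a
  ≐-shared-cross = mk⇔ (λ { ≐-direct → refl ; ≐-swapped → refl }) (λ { refl → ≐-swapped })

  ≐-unshared : ∀ {a b x y : A} → x ≢ a → x ≢ b → ¬ (x , y) ≐ (a , b)
  ≐-unshared x≢a x≢b ≐-direct  = x≢a refl
  ≐-unshared x≢a x≢b ≐-swapped = x≢b refl

  count-pairs-diagonal : ∀ a xs → count (_≐? (a , a)) (pairs xs) ≡ count (_≟ a) xs C 2
  count-pairs-diagonal a []       = refl
  count-pairs-diagonal a (x ∷ xs) with x ≟ a
  ... | yes refl = begin
    count (_≐? (a , a)) (pairs (a ∷ xs))                   ≡⟨ count-pairs-∷ (_≐? (a , a)) a xs ⟩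
    count (λ y → (a , y) ≐? (a , a)) xs + count (_≐? (a , a)) (pairs xs)
      ≡⟨ cong₂ _+_ (count-⇔ _ (_≟ a) (λ _ → ≐-shared-first) xs) (count-pairs-diagonal a xs) ⟩
    c + c C 2                                             ≡⟨ cong (_+ c C 2) (nC1≡n c) ⟨
    c C 1 + c C 2                                         ≡⟨ nCk+nC[k+1]≡[n+1]C[k+1] c 1 ⟩
    suc c C 2                                             ∎
    where
    open ≡-Reasoning
    c : ℕ
    c = count (_≟ a) xs
  ... | no x≢a = begin
    count (_≐? (a , a)) (pairs (x ∷ xs))                   ≡⟨ count-pairs-∷ (_≐? (a , a)) x xs ⟩
    count (λ y → (x , y) ≐? (a , a)) xs + count (_≐? (a , a)) (pairs xs)
      ≡⟨ cong₂ _+_ (count-none _ (λ _ → ≐-unshared x≢a x≢a) xs) (count-pairs-diagonal a xs) ⟩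
    count (_≟ a) xs C 2                                   ∎
    where open ≡-Reasoning

  count-pairs-offdiagonal : ∀ {a b} → a ≢ b → ∀ xs →
                            count (_≐? (a , b)) (pairs xs) ≡ count (_≟ a) xs * count (_≟ b) xs
  count-pairs-offdiagonal {a} {b} a≢b [] = refl
  count-pairs-offdiagonal {a} {b} a≢b (x ∷ xs) = begin
    count (_≐? (a , b)) (pairs (x ∷ xs))                        ≡⟨ count-pairs-∷ (_≐? (a , b)) x xs ⟩
    count (λ y → (x , y) ≐? (a , b)) xs + count (_≐? (a , b)) (pairs xs)
      ≡⟨ cong (count (λ y → (x , y) ≐? (a , b)) xs +_) (count-pairs-offdiagonal a≢b xs) ⟩
    count (λ y → (x , y) ≐? (a , b)) xs + A′ * B′               ≡⟨ fan (x ≟ a) (x ≟ b) ⟩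
    (indicator (x ≟ a) + A′) * (indicator (x ≟ b) + B′)          ∎
    where
    open ≡-Reasoning
    A′ B′ : ℕ
    A′ = count (_≟ a) xs
    B′ = count (_≟ b) xs
    fan : (x≟a : Dec (x ≡ a)) (x≟b : Dec (x ≡ b)) →
          count (λ y → (x , y) ≐? (a , b)) xs + A′ * B′ ≡ (indicator x≟a + A′) * (indicator x≟b + B′)
    fan (yes refl) (yes refl) = ⊥-elim (a≢b refl)
    fan (yes refl) (no _)     = cong (_+ A′ * B′) (count-⇔ _ (_≟ b) (λ _ → ≐-shared-first) xs)
    fan (no _)     (yes refl) =
      trans (cong (_+ A′ * B′) (count-⇔ _ (_≟ a) (λ _ → ≐-shared-cross) xs)) (sym (*-suc A′ B′))
    fan (no x≢a)   (no x≢b)   = cong (_+ A′ * B′) (count-none _ (λ _ → ≐-unshared x≢a x≢b) xs)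

module Mirror {A : Set} (_≟_ : DecidableEquality A) (σ : A → A)
              (σ-involutive : ∀ a → σ (σ a) ≡ a) (σ-fixpoint-free : ∀ a → σ a ≢ a) where

  open Chomp _≟_
  open UnorderedPairs _≟_

  σ₂ : A × A → A × A
  σ₂ (a , b) = σ a , σ b

  σ₂-cong : ∀ {e d} → e ≐ d → σ₂ e ≐ σ₂ d
  σ₂-cong ≐-direct  = ≐-direct
  σ₂-cong ≐-swapped = ≐-swapped

  σ₂-involutive : ∀ e → σ₂ (σ₂ e) ≐ e
  σ₂-involutive (a , b) rewrite σ-involutive a | σ-involutive b = ≐-direct

  module V = Balance (isDecEquivalence _≟_) σ (cong σ) σ-involutive
  module E = Balance ≐-isDecEquivalence σ₂ σ₂-cong σ₂-involutive

  σ-injective : ∀ {a b} → σ a ≡ σ b → a ≡ b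
  σ-injective {a} {b} σa≡σb = trans (Equivalence.to V.τ-transpose σa≡σb) (σ-involutive b)

  pairs-balanced : ∀ {xs} → V.Balanced xs → E.Balanced (pairs xs)
  pairs-balanced {xs} bal (a , b) with a ≟ b
  ... | yes refl = begin
    count (_≐? (a , a)) (pairs xs)            ≡⟨ count-pairs-diagonal a xs ⟩
    V.multiplicity a xs C 2                   ≡⟨ cong (_C 2) (bal a) ⟩
    V.multiplicity (σ a) xs C 2               ≡⟨ count-pairs-diagonal (σ a) xs ⟨
    count (_≐? (σ a , σ a)) (pairs xs)        ∎
    where open ≡-Reasoning
  ... | no a≢b = begin
    count (_≐? (a , b)) (pairs xs)                          ≡⟨ count-pairs-offdiagonal a≢b xs ⟩
    V.multiplicity a xs * V.multiplicity b xs               ≡⟨ cong₂ _*_ (bal a) (bal b) ⟩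
    V.multiplicity (σ a) xs * V.multiplicity (σ b) xs       ≡⟨ count-pairs-offdiagonal (a≢b ∘ σ-injective) xs ⟨
    count (_≐? (σ a , σ b)) (pairs xs)                      ∎
    where open ≡-Reasoning

  avoids-≐ : ∀ w {e d} → e ≐ d → avoids w e ≡ avoids w d
  avoids-≐ w ≐-direct           = refl
  avoids-≐ w (≐-swapped {a} {b}) = cong not (∨-comm (isYes (a ≟ w)) (isYes (b ≟ w)))

  avoids-σ₂ : ∀ w e → avoids w (σ₂ e) ≡ avoids (σ w) e
  avoids-σ₂ w (a , b) = cong not (cong₂ _∨_ (σ-transposes a) (σ-transposes b))
    where
    σ-transposes : ∀ a → isYes (σ a ≟ w) ≡ isYes (a ≟ σ w)
    σ-transposes a = trans (isYes≗does (σ a ≟ w))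
      (trans (does-⇔ V.τ-transpose (σ a ≟ w) (a ≟ σ w)) (sym (isYes≗does (a ≟ σ w))))

  avoids-both-balanced : ∀ v {es} → E.Balanced es →
                         E.Balanced (filterᵇ (avoids (σ v)) (filterᵇ (avoids v) es))
  avoids-both-balanced v {es} bal rewrite filterᵇ-filterᵇ (avoids (σ v)) (avoids v) es =
    E.balanced-filterᵇ {es} (λ e → avoids v e ∧ avoids (σ v) e)
      (λ e≐d → cong₂ _∧_ (avoids-≐ v e≐d) (avoids-≐ (σ v) e≐d)) (λ {e} _ → mirror-invariant e) bal
    where
    mirror-invariant : ∀ e → avoids v (σ₂ e) ∧ avoids (σ v) (σ₂ e) ≡ avoids v e ∧ avoids (σ v) e
    mirror-invariant e rewrite avoids-σ₂ v e | avoids-σ₂ (σ v) e | σ-involutive v =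
      ∧-comm (avoids (σ v) e) (avoids v e)

  self-mirror⇒antipodal : ∀ {a b} → (a , b) ≐ σ₂ (a , b) → b ≡ σ a
  self-mirror⇒antipodal e≐σe with ≐-cases e≐σe
  ... | inj₁ (a≡σa , _) = ⊥-elim (σ-fixpoint-free _ (sym a≡σa))
  ... | inj₂ (_ , b≡σa) = b≡σa

  -- Counting with multiplicity avoids carrying a duplicate-freeness invariant.
  -- An edge {a , σ a} is its own mirror image and could not be answered.
  record Symmetric (p : Position A) : Set where
    field
      vertices-balanced : V.Balanced (proj₁ p)
      edges-balanced    : E.Balanced (proj₂ p)
      no-antipodal-edge : ∀ {a b} → (a , b) ∈ proj₂ p → b ≢ σ a

  open Symmetric

  mirror-move : ∀ {p q} → Symmetric p → Move p q → Σ (Position A) λ r → Move q r × Symmetric r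
  mirror-move sym-p (delete-vertex {v} {es = es} pk)
    with _ , _ , refl , pk′ ← V.balanced⇒mirror-Pick (vertices-balanced sym-p) pk (σ-fixpoint-free v ∘ sym) =
    _ , delete-vertex pk′ , record
      { vertices-balanced = V.balanced-Pick-mirror (vertices-balanced sym-p) pk refl pk′
      ; edges-balanced    = avoids-both-balanced v {es} (edges-balanced sym-p)
      ; no-antipodal-edge = λ e∈ → no-antipodal-edge sym-p
          (proj₁ (∈-filter⁻ (T? ∘ avoids v) (proj₁ (∈-filter⁻ (T? ∘ avoids (σ v)) e∈))))
      }
  mirror-move sym-p (delete-edge pk)
    with e′ , _ , e′≐σe , pk′ ← E.balanced⇒mirror-Pick (edges-balanced sym-p) pk
                                  (no-antipodal-edge sym-p (Pick⇒∈ pk) ∘ self-mirror⇒antipodal) =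
    _ , delete-edge pk′ , record
      { vertices-balanced = vertices-balanced sym-p
      ; edges-balanced    = E.balanced-Pick-mirror (edges-balanced sym-p) pk e′≐σe pk′
      ; no-antipodal-edge = λ e∈ → no-antipodal-edge sym-p (Pick-∈ pk (Pick-∈ pk′ e∈))
      }

  nim-symmetric : ∀ f p → size p ≤ f → Symmetric p → nimF _≟_ f p ≡ 0
  nim-symmetric zero    p _      _     = refl
  nim-symmetric (suc f) p size≤ sym-p =
    nim≡0 {f = f} λ p→q → answered f p→q (≤-pred (≤-trans (Move-shrinks p→q) size≤))
    where
    answered : ∀ f {q} → Move p q → size q ≤ f → nimF _≟_ f q ≢ 0
    answered f p→q size≤f with r , q→r , sym-r ← mirror-move sym-p p→q with f
    ... | zero   = λ _ → n≮0 (<-≤-trans (Move-shrinks q→r) size≤f)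
    ... | suc f′ =
      nim≢0 {f = f′} q→r (nim-symmetric f′ r (≤-pred (≤-trans (Move-shrinks q→r) size≤f)) sym-r)

∁-involutive : ∀ {n} (s : Subset n) → ∁ (∁ s) ≡ s
∁-involutive {n} = BooleanAlgebra.¬-involutive (∪-∩-booleanAlgebra n)

∁-fixpoint-free : ∀ {n} (s : Subset (suc n)) → ∁ s ≢ s
∁-fixpoint-free (inside  ∷ s) ()
∁-fixpoint-free (outside ∷ s) ()

∣p∩∁p∣≡0 : ∀ {n} (p : Subset n) → ∣ p ∩ ∁ p ∣ ≡ 0
∣p∩∁p∣≡0 {n} p = trans (cong ∣_∣ (∩-inverseʳ p)) (∣⊥∣≡0 n)

∣∁p∣+∣p∣≡n : ∀ {n} (p : Subset n) → ∣ ∁ p ∣ + ∣ p ∣ ≡ n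
∣∁p∣+∣p∣≡n p = trans (cong (_+ ∣ p ∣) (∣∁p∣≡n∸∣p∣ p)) (m∸n+n≡m (∣p∣≤n p))

∣∁p∩∁q∣+[∣p∣+∣q∣]≡n+∣p∩q∣ : ∀ {n} (p q : Subset n) → ∣ ∁ p ∩ ∁ q ∣ + (∣ p ∣ + ∣ q ∣) ≡ n + ∣ p ∩ q ∣
∣∁p∩∁q∣+[∣p∣+∣q∣]≡n+∣p∩q∣ []            []            = refl
∣∁p∩∁q∣+[∣p∣+∣q∣]≡n+∣p∩q∣ {suc n} (inside  ∷ p) (inside  ∷ q) = begin
  ∣ ∁ p ∩ ∁ q ∣ + suc (∣ p ∣ + suc ∣ q ∣)    ≡⟨ cong (λ m → ∣ ∁ p ∩ ∁ q ∣ + suc m) (+-suc ∣ p ∣ ∣ q ∣) ⟩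
  ∣ ∁ p ∩ ∁ q ∣ + suc (suc (∣ p ∣ + ∣ q ∣))  ≡⟨ trans (+-suc _ _) (cong suc (+-suc _ _)) ⟩
  suc (suc (∣ ∁ p ∩ ∁ q ∣ + (∣ p ∣ + ∣ q ∣))) ≡⟨ cong (suc ∘ suc) (∣∁p∩∁q∣+[∣p∣+∣q∣]≡n+∣p∩q∣ p q) ⟩
  suc (suc (n + ∣ p ∩ q ∣))                  ≡⟨ cong suc (+-suc n ∣ p ∩ q ∣) ⟨
  suc (n + suc ∣ p ∩ q ∣)                    ∎
  where open ≡-Reasoning
∣∁p∩∁q∣+[∣p∣+∣q∣]≡n+∣p∩q∣ (inside  ∷ p) (outside ∷ q) =
  trans (+-suc _ _) (cong suc (∣∁p∩∁q∣+[∣p∣+∣q∣]≡n+∣p∩q∣ p q))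
∣∁p∩∁q∣+[∣p∣+∣q∣]≡n+∣p∩q∣ (outside ∷ p) (inside  ∷ q) =
  trans (cong (∣ ∁ p ∩ ∁ q ∣ +_) (+-suc ∣ p ∣ ∣ q ∣)) (trans (+-suc _ _) (cong suc (∣∁p∩∁q∣+[∣p∣+∣q∣]≡n+∣p∩q∣ p q)))
∣∁p∩∁q∣+[∣p∣+∣q∣]≡n+∣p∩q∣ (outside ∷ p) (outside ∷ q) =
  cong suc (∣∁p∩∁q∣+[∣p∣+∣q∣]≡n+∣p∩q∣ p q)

module _ {n : ℕ} where

  _≟ₛ_ : DecidableEquality (Subset n)
  _≟ₛ_ = ≡-dec _≟B_

count-allSubsets : ∀ {n} (s : Subset n) → count (_≟ₛ s) (allSubsets n) ≡ 1
count-allSubsets []      = refl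
count-allSubsets {suc n} (b ∷ s) = begin
  count (_≟ₛ (b ∷ s)) (map (outside ∷_) S ++ map (inside ∷_) S)
    ≡⟨ count-++ (_≟ₛ (b ∷ s)) (map (outside ∷_) S) (map (inside ∷_) S) ⟩
  count (_≟ₛ (b ∷ s)) (map (outside ∷_) S) + count (_≟ₛ (b ∷ s)) (map (inside ∷_) S)
    ≡⟨ cong₂ _+_ (count-map (_≟ₛ (b ∷ s)) (outside ∷_) S) (count-map (_≟ₛ (b ∷ s)) (inside ∷_) S) ⟩
  count (λ t → (outside ∷ t) ≟ₛ (b ∷ s)) S + count (λ t → (inside ∷ t) ≟ₛ (b ∷ s)) S
    ≡⟨ by-head b ⟩
  1 ∎
  where
  open ≡-Reasoning
  S : List (Subset n)
  S = allSubsets n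
  same-head : ∀ c → count (λ t → (c ∷ t) ≟ₛ (c ∷ s)) S ≡ 1
  same-head c = trans (count-⇔ _ (_≟ₛ s) (λ t → mk⇔ (proj₂ ∘ ∷-injective) (cong (c ∷_))) S) (count-allSubsets s)
  other-head : ∀ {c d} → c ≢ d → count (λ t → (c ∷ t) ≟ₛ (d ∷ s)) S ≡ 0
  other-head c≢d = count-none _ (λ t → c≢d ∘ proj₁ ∘ ∷-injective) S
  by-head : ∀ b → count (λ t → (outside ∷ t) ≟ₛ (b ∷ s)) S + count (λ t → (inside ∷ t) ≟ₛ (b ∷ s)) S ≡ 1
  by-head outside = cong₂ _+_ (same-head outside) (other-head λ ())
  by-head inside  = cong₂ _+_ (other-head λ ()) (same-head inside)

-- The ground set has size suc n so that complementation has no fixed point.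
module EvenJohnson (n k : ℕ) (n≡k+k : suc n ≡ k + k) where

  open Graph (Johnson (suc n) k) using (vertices; edges)
  open Mirror (_≟ₛ_ {suc n}) ∁ ∁-involutive ∁-fixpoint-free public

  ∣∁s∣≡k⇔∣s∣≡k : ∀ s → ∣ ∁ s ∣ ≡ k ⇔ ∣ s ∣ ≡ k
  ∣∁s∣≡k⇔∣s∣≡k s = mk⇔
    (λ ∣∁s∣≡k → +-cancelˡ-≡ k _ _ (trans (cong (_+ ∣ s ∣) (sym ∣∁s∣≡k)) (trans (∣∁p∣+∣p∣≡n s) n≡k+k)))
    (λ ∣s∣≡k → +-cancelʳ-≡ k _ _ (trans (cong (∣ ∁ s ∣ +_) (sym ∣s∣≡k)) (trans (∣∁p∣+∣p∣≡n s) n≡k+k)))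

  ∣∁p∩∁q∣≡∣p∩q∣ : ∀ {p q} → ∣ p ∣ ≡ k → ∣ q ∣ ≡ k → ∣ ∁ p ∩ ∁ q ∣ ≡ ∣ p ∩ q ∣
  ∣∁p∩∁q∣≡∣p∩q∣ {p} {q} ∣p∣≡k ∣q∣≡k = +-cancelʳ-≡ (k + k) _ _ (begin
    ∣ ∁ p ∩ ∁ q ∣ + (k + k)            ≡⟨ cong (∣ ∁ p ∩ ∁ q ∣ +_) (cong₂ _+_ ∣p∣≡k ∣q∣≡k) ⟨
    ∣ ∁ p ∩ ∁ q ∣ + (∣ p ∣ + ∣ q ∣)    ≡⟨ ∣∁p∩∁q∣+[∣p∣+∣q∣]≡n+∣p∩q∣ p q ⟩
    suc n + ∣ p ∩ q ∣                  ≡⟨ trans (cong (_+ ∣ p ∩ q ∣) n≡k+k) (+-comm (k + k) _) ⟩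
    ∣ p ∩ q ∣ + (k + k)                ∎)
    where open ≡-Reasoning

  of-size-k : Subset (suc n) → Bool
  of-size-k s = ∣ s ∣ ≡ᵇ k

  adjacent : Subset (suc n) × Subset (suc n) → Bool
  adjacent (p , q) = suc ∣ p ∩ q ∣ ≡ᵇ k

  ∈-vertices⁻ : ∀ {s} → s ∈ vertices → ∣ s ∣ ≡ k
  ∈-vertices⁻ s∈ = ≡ᵇ⇒≡ _ k (proj₂ (∈-filter⁻ (T? ∘ of-size-k) {xs = allSubsets (suc n)} s∈))

  vertices-balanced : V.Balanced vertices
  vertices-balanced = V.balanced-filterᵇ {allSubsets (suc n)} of-size-k (cong of-size-k)
    (λ {s} _ → does-⇔ (∣∁s∣≡k⇔∣s∣≡k s) (∣ ∁ s ∣ ≟ℕ k) (∣ s ∣ ≟ℕ k))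
    (λ s → trans (count-allSubsets s) (sym (count-allSubsets (∁ s))))

  edges-balanced : E.Balanced edges
  edges-balanced = E.balanced-filterᵇ {pairs vertices} adjacent adjacent-≐ adjacent-σ₂
                     (pairs-balanced {vertices} vertices-balanced)
    where
    adjacent-≐ : ∀ {e d} → e ≐ d → adjacent e ≡ adjacent d
    adjacent-≐ ≐-direct            = refl
    adjacent-≐ (≐-swapped {p} {q}) = cong (λ s → suc ∣ s ∣ ≡ᵇ k) (∩-comm p q)
    adjacent-σ₂ : ∀ {e} → e ∈ pairs vertices → adjacent (σ₂ e) ≡ adjacent e
    adjacent-σ₂ {p , q} e∈ with p∈ , q∈ ← ∈-pairs⁻ vertices e∈ =
      cong (λ m → suc m ≡ᵇ k) (∣∁p∩∁q∣≡∣p∩q∣ {p} {q} (∈-vertices⁻ p∈) (∈-vertices⁻ q∈))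

  no-antipodal : 2 ≤ k → ∀ {p q} → (p , q) ∈ edges → q ≢ ∁ p
  no-antipodal 2≤k {p} e∈ refl = <-irrefl 1≡k 2≤k
    where
    1≡k : 1 ≡ k
    1≡k = trans (cong suc (sym (∣p∩∁p∣≡0 p)))
                (≡ᵇ⇒≡ _ k (proj₂ (∈-filter⁻ (T? ∘ adjacent) {xs = pairs vertices} e∈)))

  johnson-symmetric : 2 ≤ k → Symmetric (vertices , edges)
  johnson-symmetric 2≤k = record
    { vertices-balanced = vertices-balanced
    ; edges-balanced    = edges-balanced
    ; no-antipodal-edge = no-antipodal 2≤k
    }

nim-johnson-even : (k : ℕ) → 2 ≤ k → Nim (Johnson (2 * k) k) ≡ 0
nim-johnson-even (suc zero)    (s≤s ())
nim-johnson-even (suc (suc m)) 2≤k = nim-symmetric _ _ ≤-refl (johnson-symmetric 2≤k)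
  where
  open EvenJohnson (suc (m + 1 * suc (suc m))) (suc (suc m))
                   (cong (suc (suc m) +_) (+-identityʳ (suc (suc m))))

proposition3p3 : Nim (Johnson 0 0) ≡ 1
                 × Nim (Johnson 2 1) ≡ 2
                 × ((k : ℕ) → 2 ≤ k → Nim (Johnson (2 * k) k) ≡ 0)
proposition3p3 = refl , refl , nim-johnson-even
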